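{- Let $n\ge 2$. For every integer $j\ge 0$, $\mathcal{N}_j=N_{\mathcal{B}}(\mathcal{N}_{j-1})$, i.e. $\mathcal{N}_j=\{b\in\mathcal{B}: [b,h]\in\mathbb{Z}\mathcal{N}_{j-1}\text{ for all } h\in\mathcal{N}_{j-1}\}$.
   Context: Let $n\ge 2$ be an integer. A partition is a sequence $\Lambda=(\lambda_t)_{t\ge 1}$ of non-negative integers with finite support; $\mathrm{wt}(\Lambda)=\sum_t t\lambda_t$; $x^\Lambda=\prod_t x_t^{\lambda_t}$ (monomial in commuting indeterminates), $\deg(x^\Lambda)=\sum_t\lambda_t$. $\mathrm{Part}(j)$ is the set of partitions with $\lambda_t=0$ for $t>j$; $\partial_k$ is the partial derivative with respect to $x_k$. Let $\mathcal{B}=\{x^\Lambda\partial_k:1\le k\le n,\ \Lambda\in\mathrm{Part}(k-1)\}$ and let $\mathfrak{L}(n)$ be the free $\mathbb{Z}$-module with basis $\mathcal{B}$, with Lie bracket defined on $\mathcal{B}$ by $[x^\Lambda\partial_k,x^\Theta\partial_u]=\partial_u(x^\Lambda)x^\Theta\partial_k$ if $u<k$, $=-x^\Lambda\partial_k(x^\Theta)\partial_u$ if $u>k$, $=0$ if $u=k$, extended bilinearly. For $\mathcal{H}\subseteq\mathcal{B}$, $\mathbb{Z}\mathcal{H}$ is its $\mathbb{Z}$-span and $N_{\mathcal{B}}(\mathcal{H})=\{b\in\mathcal{B}:[b,h]\in\mathbb{Z}\mathcal{H}\ \forall h\in\mathcal{H}\}$. For an integer $i\ge -1$ let $r_i\in\{1,\dots,n-1\}$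 with $i\equiv r_i\pmod{n-1}$ and $h_i=\lfloor (i-1)/(n-1)\rfloor+1$. For $x^\Lambda\partial_k\in\mathcal{B}$ define $\mathrm{WD}(x^\Lambda\partial_k)=\mathrm{wt}(\Lambda)-\deg(x^\Lambda)+n-k$ and $\mathrm{lev}_i(x^\Lambda\partial_k)=h_i\,\mathrm{WD}(x^\Lambda\partial_k)+\deg(x^\Lambda)-1$. For $i\ge -1$ let $\mathcal{N}_i=\{b\in\mathcal{B}: \mathrm{lev}_j(b)\le j \text{ for some integer } j \text{ with } -1\le j\le i\}$. -}

module Defs where

open import Data.Nat as ℕ using (ℕ; zero; suc)
open import Data.Nat.Properties using (<-cmp)
open import Data.Integer as ℤ using (ℤ; +_; -_; _/ℕ_)
open import Data.Fin using (Fin; toℕ)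
open import Data.Fin.Properties using () renaming (_≟_ to _≟F_)
open import Data.Vec using (Vec; []; _∷_; lookup; zipWith; updateAt)
import Data.Vec.Properties as VP
import Data.Product.Properties as PP
open import Data.List using (List; []; _∷_)
open import Data.List.Relation.Unary.All using (All)
open import Data.Product using (Σ; _×_; _,_; proj₁; proj₂; ∃)
open import Relation.Binary using (tri<; tri≈; tri>)
open import Relation.Binary.PropositionalEquality using (_≡_)
open import Relation.Nullary using (Dec; yes; no)
open import Function.Bundles using (_⇔_)

-- A monomial x^Λ in x_1,…,x_n is a vector Λ : Vec ℕ n, whose entry at
-- (0-based) position t is the exponent λ_{t+1}.  (Elements of 𝓑 only
-- involve x_1,…,x_{n-1}, so this loses nothing.)
-- A raw basis symbol x^Λ ∂_k is a pair (k' , Λ), k' : Fin n, k = toℕ k' + 1.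

Mono : ℕ → Set
Mono n = Vec ℕ n

RawB : ℕ → Set
RawB n = Fin n × Mono n

idx : ∀ {n} → RawB n → ℕ
idx (k' , _) = suc (toℕ k')

-- membership in 𝓑 : Λ ∈ Part(k-1), i.e. λ_t = 0 for all t > k - 1
InB : ∀ {n} → RawB n → Set
InB {n} (k' , Λ) = (t : Fin n) → toℕ k' ℕ.≤ toℕ t → lookup Λ t ≡ 0

_≟B_ : ∀ {n} (b c : RawB n) → Dec (b ≡ c)
_≟B_ = PP.≡-dec _≟F_ (VP.≡-dec ℕ._≟_)

-- 𝔏(n): formal ℤ-linear combinations of basis symbols, compared via
-- their coefficient functions (the free ℤ-module on 𝓑).

Elt : ℕ → Set
Elt n = List (ℤ × RawB n)

coeff : ∀ {n} → Elt n → RawB n → ℤ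
coeff [] c = + 0
coeff ((a , b) ∷ v) c with b ≟B c
... | yes _ = a ℤ.+ coeff v c
... | no  _ = coeff v c

InSpan : ∀ {n} → (RawB n → Set) → Elt n → Set
InSpan {n} H v =
  Σ (Elt n) λ w → All (λ p → H (proj₂ p)) w × ((c : RawB n) → coeff v c ≡ coeff w c)

-- Lie bracket on basis symbols.
-- ∂_u(x^Λ) = λ_u x^{Λ - e_u};  monomial product = addition of exponents.

decAt : ∀ {n} → Fin n → Mono n → Mono n
decAt t Λ = updateAt Λ t ℕ.pred

mul : ∀ {n} → Mono n → Mono n → Mono n
mul = zipWith ℕ._+_

bracket : ∀ {n} → RawB n → RawB n → Elt n
bracket (k , Λ) (u , Θ) with <-cmp (toℕ u) (toℕ k)
-- u < k :  ∂_u(x^Λ) x^Θ ∂_k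
... | tri< _ _ _ = (+ lookup Λ u , (k , mul (decAt u Λ) Θ)) ∷ []
... | tri≈ _ _ _ = []
-- u > k :  - x^Λ ∂_k(x^Θ) ∂_u
... | tri> _ _ _ = (- (+ lookup Θ k) , (u , mul Λ (decAt k Θ))) ∷ []

Normalizer : ∀ {n} → (RawB n → Set) → RawB n → Set
Normalizer {n} H b = InB b × ((h : RawB n) → H h → InSpan H (bracket b h))

wtFrom : ∀ {m} → ℕ → Vec ℕ m → ℕ
wtFrom t [] = 0
wtFrom t (x ∷ xs) = t ℕ.* x ℕ.+ wtFrom (suc t) xs

wt : ∀ {m} → Vec ℕ m → ℕ
wt = wtFrom 1

deg : ∀ {m} → Vec ℕ m → ℕ
deg [] = 0
deg (x ∷ xs) = x ℕ.+ deg xs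

WD : ∀ {n} → RawB n → ℤ
WD {n} (k , Λ) = + wt Λ ℤ.- + deg Λ ℤ.+ + n ℤ.- + idx (k , Λ)

-- h_i = ⌊(i-1)/(n-1)⌋ + 1 ; the divisor n - 1 is written suc (n ∸ 2),
-- which equals n - 1 under the standing hypothesis n ≥ 2.
hgt : ℕ → ℤ → ℤ
hgt n i = ((i ℤ.- + 1) /ℕ suc (n ℕ.∸ 2)) ℤ.+ + 1

lev : ∀ {n} → ℤ → RawB n → ℤ
lev {n} i b = hgt n i ℤ.* WD b ℤ.+ + deg (proj₂ b) ℤ.- + 1

𝓝 : (n : ℕ) → ℤ → RawB n → Set
𝓝 n i b = InB b × Σ ℤ λ j → (ℤ.-1ℤ ℤ.≤ j) × (j ℤ.≤ i) × (lev j b ℤ.≤ j)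

-- Write W = WD b and d = deg b. For i ≥ 0, b ∈ 𝓝_i says h_j W + d ≤ j + 1 for some j ≤ i, where
-- h_j = ⌈j/(n-1)⌉; in particular every element of degree ≤ 1 lies in every 𝓝_i. A bracket [b, c] is
-- a single multiple of a basis element x with WD x = WD b + WD c - (n - 1) and deg x = deg b + deg c - 1,
-- so [𝓝_j, 𝓝_{j-1}] ⊆ ℤ𝓝_{j-1} becomes an inequality between ceilings.
-- Conversely, let deg b ≥ 2 normalise 𝓝_{j-1}. Bracketing b with a probe x₁^c x_v ∂_{v+1}
-- (c = ⌊(j-1)/(n-1)⌋, WD = n - 2) lying in 𝓝_{j-1}, or with ∂₁ when b = x₁^d ∂_n, produces a nonzero
-- multiple of an element of 𝓝_{j-1}, from whose level that of b is read off.

module Submission where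

open import Defs
open import Data.Nat using (ℕ; _≤_)
open import Data.Integer using (+_; _-_)
open import Function.Bundles using (_⇔_)

open import Data.Nat as ℕ
  using (zero; suc; _+_; _*_; _∸_; _<_; z≤n; s≤s; _/_; _%_; _≤?_)
open import Data.Nat.Properties
open import Data.Nat.DivMod using (m≡m%n+[m/n]*n; m%n<n; m/n*n≤m; /-monoˡ-≤)
open import Data.Nat.Tactic.RingSolver using (solve-∀)
open import Algebra.Properties.CommutativeSemigroup +-commutativeSemigroup using (interchange; xy∙z≈xz∙y)
open import Data.Fin using (Fin; zero; suc; toℕ; inject₁)
open import Data.Fin.Properties using (toℕ<n; toℕ-fromℕ<; toℕ-inject₁)
import Data.Integer as ℤ
import Data.Integer.Properties as ℤP
open import Function using (_∘_)
open import Function.Bundles using (mk⇔)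
open import Data.List using ([]; _∷_)
open import Data.List.Relation.Unary.All as All using (All; []; _∷_)
open import Data.Vec using (Vec; []; _∷_; lookup; replicate)
open import Data.Vec.Properties using (lookup-zipWith; lookup-replicate; zipWith-comm)
open import Data.Product using (∃-syntax; _×_; _,_; proj₁; proj₂)
open import Data.Sum using (_⊎_; inj₁; inj₂)
open import Data.Empty using (⊥-elim)
open import Relation.Binary.PropositionalEquality
open import Relation.Nullary using (yes; no)
open import Relation.Binary using (tri<; tri≈; tri>)

zeros : ∀ {q} → Vec ℕ q
zeros = replicate _ 0

unit : ∀ {q} → Fin q → ℕ → Vec ℕ q
unit zero    v = v ∷ zeros
unit (suc p) v = 0 ∷ unit p v

deg-zeros : ∀ q → deg (zeros {q}) ≡ 0
deg-zeros zero    = refl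
deg-zeros (suc q) = deg-zeros q

wtFrom-zeros : ∀ q t → wtFrom t (zeros {q}) ≡ 0
wtFrom-zeros zero    t = refl
wtFrom-zeros (suc q) t rewrite *-zeroʳ t = wtFrom-zeros q (suc t)

lookup-unit-same : ∀ {q} (p : Fin q) v → lookup (unit p v) p ≡ v
lookup-unit-same zero    v = refl
lookup-unit-same (suc p) v = lookup-unit-same p v

lookup-unit-other : ∀ {q} (p t : Fin q) v → toℕ p ≢ toℕ t → lookup (unit p v) t ≡ 0
lookup-unit-other zero    zero    v p≢t = ⊥-elim (p≢t refl)
lookup-unit-other zero    (suc t) v p≢t = lookup-replicate t 0
lookup-unit-other (suc p) zero    v p≢t = refl
lookup-unit-other (suc p) (suc t) v p≢t = lookup-unit-other p t v (p≢t ∘ cong suc)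

deg-unit : ∀ {q} (p : Fin q) v → deg (unit p v) ≡ v
deg-unit {suc q} zero v = trans (cong (_+_ v) (deg-zeros q)) (+-identityʳ v)
deg-unit (suc p) v = deg-unit p v

wtFrom-unit : ∀ {q} t (p : Fin q) v → wtFrom t (unit p v) ≡ (t + toℕ p) * v
wtFrom-unit {suc q} t zero v
  rewrite wtFrom-zeros q (suc t) | +-identityʳ (t * v) | +-identityʳ t = refl
wtFrom-unit t (suc p) v
  rewrite *-zeroʳ t | wtFrom-unit (suc t) p v | +-suc t (toℕ p) = refl

deg-mul : ∀ {q} (A B : Vec ℕ q) → deg (mul A B) ≡ deg A + deg B
deg-mul []      []      = refl
deg-mul (x ∷ A) (y ∷ B) rewrite deg-mul A B = interchange x y (deg A) (deg B)

wtFrom-mul : ∀ {q} t (A B : Vec ℕ q) → wtFrom t (mul A B) ≡ wtFrom t A + wtFrom t B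
wtFrom-mul t []      []      = refl
wtFrom-mul t (x ∷ A) (y ∷ B) rewrite wtFrom-mul (suc t) A B | *-distribˡ-+ t x y =
  interchange (t * x) (t * y) (wtFrom (suc t) A) (wtFrom (suc t) B)

lookup-decAt-≤ : ∀ {q} (A : Vec ℕ q) u t → lookup (decAt u A) t ≤ lookup A t
lookup-decAt-≤ (x ∷ A) zero    zero    = pred[n]≤n
lookup-decAt-≤ (x ∷ A) zero    (suc t) = ≤-refl
lookup-decAt-≤ (x ∷ A) (suc u) zero    = ≤-refl
lookup-decAt-≤ (x ∷ A) (suc u) (suc t) = lookup-decAt-≤ A u t

deg-decAt : ∀ {q} (A : Vec ℕ q) u → 1 ≤ lookup A u → deg (decAt u A) + 1 ≡ deg A
deg-decAt (suc x ∷ A) zero    _   = +-comm (x + deg A) 1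
deg-decAt (x ∷ A)     (suc u) A≥1 =
  trans (+-assoc x (deg (decAt u A)) 1) (cong (_+_ x) (deg-decAt A u A≥1))

wtFrom-decAt : ∀ {q} t (A : Vec ℕ q) u → 1 ≤ lookup A u →
               wtFrom t (decAt u A) + (t + toℕ u) ≡ wtFrom t A
wtFrom-decAt t (suc x ∷ A) zero _ rewrite *-suc t x | +-identityʳ t = rearrange (t * x) (wtFrom (suc t) A) t
  where rearrange : ∀ a b c → a + b + c ≡ c + a + b
        rearrange = solve-∀
wtFrom-decAt t (x ∷ A) (suc u) A≥1
  rewrite +-assoc (t * x) (wtFrom (suc t) (decAt u A)) (t + suc (toℕ u)) | +-suc t (toℕ u) =
  cong (_+_ (t * x)) (wtFrom-decAt (suc t) A u A≥1)

wtFrom-suc-≤ : ∀ {q} t (A : Vec ℕ q) → wtFrom t A ≤ wtFrom (suc t) A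
wtFrom-suc-≤ t []      = z≤n
wtFrom-suc-≤ t (x ∷ A) = +-mono-≤ (*-monoˡ-≤ x (n≤1+n t)) (wtFrom-suc-≤ (suc t) A)

deg≤wtFrom : ∀ {q} t (A : Vec ℕ q) → deg A ≤ wtFrom (suc t) A
deg≤wtFrom t []      = z≤n
deg≤wtFrom t (x ∷ A) = +-mono-≤ (m≤n*m x (suc t)) (≤-trans (deg≤wtFrom t A) (wtFrom-suc-≤ (suc t) A))

VanishesBeyond : ∀ {q} → ℕ → ℕ → Vec ℕ q → Set
VanishesBeyond K t A = ∀ p → K < t + toℕ p → lookup A p ≡ 0

VanishesBeyond-tail : ∀ {q} K t x (A : Vec ℕ q) → VanishesBeyond K t (x ∷ A) → VanishesBeyond K (suc t) A
VanishesBeyond-tail K t x A vanish p = vanish (suc p) ∘ subst (K <_) (sym (+-suc t (toℕ p)))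

wtFrom≤*deg : ∀ {q} t K (A : Vec ℕ q) → VanishesBeyond K t A → wtFrom t A ≤ K * deg A
wtFrom≤*deg t K []      vanish = z≤n
wtFrom≤*deg t K (x ∷ A) vanish with t ≤? K
... | yes t≤K rewrite *-distribˡ-+ K x (deg A) =
  +-mono-≤ (*-monoˡ-≤ x t≤K) (wtFrom≤*deg (suc t) K A (VanishesBeyond-tail K t x A vanish))
... | no t≰K with vanish zero (subst (K <_) (sym (+-identityʳ t)) (≰⇒> t≰K))
... | refl rewrite *-zeroʳ t = wtFrom≤*deg (suc t) K A (VanishesBeyond-tail K t 0 A vanish)

deg≡0⇒wtFrom≡0 : ∀ {q} t (A : Vec ℕ q) → deg A ≡ 0 → wtFrom t A ≡ 0
deg≡0⇒wtFrom≡0 t []         _  = refl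
deg≡0⇒wtFrom≡0 t (zero ∷ A) d0 rewrite *-zeroʳ t = deg≡0⇒wtFrom≡0 (suc t) A d0

positive-entry : ∀ {q} (A : Vec ℕ q) → 1 ≤ deg A → ∃[ u ] 1 ≤ lookup A u
positive-entry (zero  ∷ A) A≥1 = let u , Au≥1 = positive-entry A A≥1 in suc u , Au≥1
positive-entry (suc x ∷ A) _   = zero , s≤s z≤n

deg≡0⊎positive-entry : ∀ {q} (A : Vec ℕ q) → deg A ≡ 0 ⊎ ∃[ u ] 1 ≤ lookup A u
deg≡0⊎positive-entry A with deg A ℕ.≟ 0
... | yes d0 = inj₁ d0
... | no  d≢0 = inj₂ (positive-entry A (n≢0⇒n>0 d≢0))

InB⇒wt≤k*deg : ∀ {n} (k : Fin n) (Λ : Mono n) → InB (k , Λ) → wt Λ ≤ toℕ k * deg Λ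
InB⇒wt≤k*deg k Λ inB = wtFrom≤*deg 1 (toℕ k) Λ (λ p → inB p ∘ ≤-pred)

dg : ∀ {n} → RawB n → ℕ
dg b = deg (proj₂ b)

excess : ∀ {q} → Vec ℕ q → ℕ
excess A = wt A ∸ deg A

wd : ∀ {n} → RawB n → ℕ
wd {n} (k , Λ) = excess Λ + (n ∸ suc (toℕ k))

WD≡wd : ∀ {n} (b : RawB n) → WD b ≡ + wd b
WD≡wd {n} (k , Λ) = begin
  + wt Λ - + deg Λ ℤ.+ + n - + suc (toℕ k)
    ≡⟨ cong (λ z → z ℤ.+ + n - + suc (toℕ k)) (trans (ℤP.m-n≡m⊖n (wt Λ) (deg Λ)) (ℤP.⊖-≥ (deg≤wtFrom 0 Λ))) ⟩
  + (excess Λ) ℤ.+ + n - + suc (toℕ k)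
    ≡⟨ cong (_- + suc (toℕ k)) (ℤP.pos-+ (excess Λ) n) ⟨
  + (excess Λ + n) - + suc (toℕ k)
    ≡⟨ trans (ℤP.m-n≡m⊖n (excess Λ + n) (suc (toℕ k))) (ℤP.⊖-≥ (≤-trans (toℕ<n k) (m≤n+m n (excess Λ)))) ⟩
  + (excess Λ + n ∸ suc (toℕ k))
    ≡⟨ cong +_ (+-∸-assoc (excess Λ) (toℕ<n k)) ⟩
  + wd (k , Λ) ∎
  where open ≡-Reasoning

wt≡excess+deg : ∀ {q} (A : Vec ℕ q) → wt A ≡ excess A + deg A
wt≡excess+deg A = sym (m∸n+n≡m (deg≤wtFrom 0 A))

mul-comm : ∀ {q} (A B : Vec ℕ q) → mul A B ≡ mul B A
mul-comm = zipWith-comm +-comm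

module _ {q} (A B : Vec ℕ q) (u : Fin q) (Au≥1 : 1 ≤ lookup A u) where

  deg-mul-decAt : deg (mul (decAt u A) B) + 1 ≡ deg A + deg B
  deg-mul-decAt = begin
    deg (mul (decAt u A) B) + 1   ≡⟨ cong (_+ 1) (deg-mul (decAt u A) B) ⟩
    deg (decAt u A) + deg B + 1   ≡⟨ xy∙z≈xz∙y (deg (decAt u A)) (deg B) 1 ⟩
    deg (decAt u A) + 1 + deg B   ≡⟨ cong (_+ deg B) (deg-decAt A u Au≥1) ⟩
    deg A + deg B                 ∎
    where open ≡-Reasoning

  wt-mul-decAt : wt (mul (decAt u A) B) + (1 + toℕ u) ≡ wt A + wt B
  wt-mul-decAt = begin
    wt (mul (decAt u A) B) + (1 + toℕ u)   ≡⟨ cong (_+ (1 + toℕ u)) (wtFrom-mul 1 (decAt u A) B) ⟩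
    wt (decAt u A) + wt B + (1 + toℕ u)    ≡⟨ xy∙z≈xz∙y (wt (decAt u A)) (wt B) (1 + toℕ u) ⟩
    wt (decAt u A) + (1 + toℕ u) + wt B    ≡⟨ cong (_+ wt B) (wtFrom-decAt 1 A u Au≥1) ⟩
    wt A + wt B                            ∎
    where open ≡-Reasoning

  excess-mul-decAt : excess (mul (decAt u A) B) + toℕ u ≡ excess A + excess B
  excess-mul-decAt = +-cancelʳ-≡ (dX + 1) _ _ (begin
    eX + t + (dX + 1)        ≡⟨ regroup eX t dX ⟩
    (eX + dX) + (1 + t)      ≡⟨ cong (_+ (1 + t)) (wt≡excess+deg X) ⟨
    wt X + (1 + t)           ≡⟨ wt-mul-decAt ⟩
    wt A + wt B              ≡⟨ cong₂ _+_ (wt≡excess+deg A) (wt≡excess+deg B) ⟩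
    (eA + dA) + (eB + dB)    ≡⟨ interchange eA dA eB dB ⟩
    eA + eB + (dA + dB)      ≡⟨ cong (_+_ (eA + eB)) deg-mul-decAt ⟨
    eA + eB + (dX + 1)       ∎)
    where
      open ≡-Reasoning
      X = mul (decAt u A) B
      t = toℕ u
      eX = excess X
      eA = excess A
      eB = excess B
      dX = deg X
      dA = deg A
      dB = deg B
      regroup : ∀ a b c → a + b + (c + 1) ≡ (a + c) + (1 + b)
      regroup = solve-∀

InB-weaken : ∀ {n} {k k′ : Fin n} {Λ} → toℕ k ≤ toℕ k′ → InB (k , Λ) → InB (k′ , Λ)
InB-weaken k≤k′ inB t k′≤t = inB t (≤-trans k≤k′ k′≤t)

InB-mul-decAt : ∀ {n} {k u : Fin n} {A B} → InB (k , A) → InB (k , B) → InB (k , mul (decAt u A) B)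
InB-mul-decAt {u = u} {A} {B} A∈ B∈ t k≤t = begin
  lookup (mul (decAt u A) B) t      ≡⟨ lookup-zipWith _+_ t (decAt u A) B ⟩
  lookup (decAt u A) t + lookup B t ≡⟨ cong₂ _+_ decAt-vanishes (B∈ t k≤t) ⟩
  0                                 ∎
  where open ≡-Reasoning
        decAt-vanishes = n≤0⇒n≡0 (≤-trans (lookup-decAt-≤ A u t) (≤-reflexive (A∈ t k≤t)))

module _ {n} {k u : Fin n} (Λ Θ : Mono n) where

  bracket-< : toℕ u < toℕ k → bracket (k , Λ) (u , Θ) ≡ (+ lookup Λ u , (k , mul (decAt u Λ) Θ)) ∷ []
  bracket-< u<k with <-cmp (toℕ u) (toℕ k)
  ... | tri< _ _ _   = refl
  ... | tri≈ _ u≡k _ = ⊥-elim (<⇒≢ u<k u≡k)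
  ... | tri> _ _ u>k = ⊥-elim (<⇒≯ u<k u>k)

  bracket-> : toℕ k < toℕ u → bracket (k , Λ) (u , Θ) ≡ (ℤ.- (+ lookup Θ k) , (u , mul Λ (decAt k Θ))) ∷ []
  bracket-> k<u with <-cmp (toℕ u) (toℕ k)
  ... | tri< u<k _ _ = ⊥-elim (<⇒≯ k<u u<k)
  ... | tri≈ _ u≡k _ = ⊥-elim (<⇒≢ k<u (sym u≡k))
  ... | tri> _ _ _   = refl

module _ {n} {H : RawB n → Set} where

  InSpan-[] : InSpan H []
  InSpan-[] = [] , [] , λ _ → refl

  private
    coeff-cong-∷ : ∀ {v w : Elt n} z x → (∀ c → coeff v c ≡ coeff w c) →
                   ∀ c → coeff ((z , x) ∷ v) c ≡ coeff ((z , x) ∷ w) c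
    coeff-cong-∷ z x v≈w c with x ≟B c
    ... | yes _ = cong (ℤ._+_ z) (v≈w c)
    ... | no  _ = v≈w c

  InSpan-∷ : ∀ {v} z {x} → H x → InSpan H v → InSpan H ((z , x) ∷ v)
  InSpan-∷ z {x} Hx (w , Hw , v≈w) = (z , x) ∷ w , Hx ∷ Hw , coeff-cong-∷ z x v≈w

  InSpan-∷-0 : ∀ {v} x → InSpan H v → InSpan H ((+ 0 , x) ∷ v)
  InSpan-∷-0 x (w , Hw , v≈w) = w , Hw , λ c → trans (coeff-cong-∷ (+ 0) x v≈w c) (drop-0 c)
    where drop-0 : ∀ c → coeff ((+ 0 , x) ∷ w) c ≡ coeff w c
          drop-0 c with x ≟B c
          ... | yes _ = ℤP.+-identityˡ (coeff w c)
          ... | no  _ = refl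

  InSpan-support : ∀ {v} → All (λ t → proj₁ t ≢ + 0 → H (proj₂ t)) v → InSpan H v
  InSpan-support []                   = InSpan-[]
  InSpan-support {(z , x) ∷ _} (Hx ∷ Hv) with z ℤ.≟ + 0
  ... | yes refl = InSpan-∷-0 x (InSpan-support Hv)
  ... | no  z≢0  = InSpan-∷ z (Hx z≢0) (InSpan-support Hv)

  coeff≢0⇒∈ : ∀ {v} x → InSpan H v → coeff v x ≢ + 0 → H x
  coeff≢0⇒∈ x (w , Hw , v≈w) vx≢0 = ∈-support w Hw (vx≢0 ∘ trans (v≈w x))
    where ∈-support : ∀ w → All (H ∘ proj₂) w → coeff w x ≢ + 0 → H x
          ∈-support []            []        wx≢0 = ⊥-elim (wx≢0 refl)
          ∈-support ((_ , y) ∷ w) (Hy ∷ Hw) wx≢0 with y ≟B x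
          ... | yes refl = Hy
          ... | no  _    = ∈-support w Hw wx≢0

  InSpan-single⇒∈ : ∀ z x → InSpan H ((z , x) ∷ []) → z ≢ + 0 → H x
  InSpan-single⇒∈ z x z∙x∈ z≢0 = coeff≢0⇒∈ {(z , x) ∷ []} x z∙x∈ (z≢0 ∘ trans (sym coeff-self))
    where coeff-self : coeff ((z , x) ∷ []) x ≡ z
          coeff-self with x ≟B x
          ... | yes _   = ℤP.+-identityʳ z
          ... | no  x≢x = ⊥-elim (x≢x refl)

module _ {n} {H : RawB n → Set} (k : Fin n) (Λ : Mono n)
         (normalizes : ∀ h → H h → InSpan H (bracket (k , Λ) h)) (u : Fin n) (Θ : Mono n) (c∈ : H (u , Θ)) where

  normalized-term-< : toℕ u < toℕ k → 1 ≤ lookup Λ u → H (k , mul (decAt u Λ) Θ)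
  normalized-term-< u<k Λu≥1 =
    InSpan-single⇒∈ _ _ (subst (InSpan H) (bracket-< Λ Θ u<k) (normalizes (u , Θ) c∈))
                        (n>0⇒n≢0 Λu≥1 ∘ ℤP.+-injective)

  normalized-term-> : toℕ k < toℕ u → 1 ≤ lookup Θ k → H (u , mul Λ (decAt k Θ))
  normalized-term-> k<u Θk≥1 =
    InSpan-single⇒∈ _ _ (subst (InSpan H) (bracket-> Λ Θ k<u) (normalizes (u , Θ) c∈))
                        (n>0⇒n≢0 Θk≥1 ∘ ℤP.+-injective ∘ ℤP.neg-injective)

InB⇒positive-entry-below : ∀ {n} (k : Fin n) Λ u → InB (k , Λ) → 1 ≤ lookup Λ u → toℕ u < toℕ k
InB⇒positive-entry-below k Λ u Λ∈ Λu≥1 with toℕ k ≤? toℕ u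
... | yes k≤u = ⊥-elim (1+n≰n (≤-trans Λu≥1 (≤-reflexive (Λ∈ u k≤u))))
... | no  k≰u = ≰⇒> k≰u

+a≢0⇒1≤a : ∀ {a} → + a ≢ + 0 → 1 ≤ a
+a≢0⇒1≤a {zero}  a≢0 = ⊥-elim (a≢0 refl)
+a≢0⇒1≤a {suc _} _   = s≤s z≤n

-a≢0⇒1≤a : ∀ {a} → ℤ.- (+ a) ≢ + 0 → 1 ≤ a
-a≢0⇒1≤a {zero}  a≢0 = ⊥-elim (a≢0 refl)
-a≢0⇒1≤a {suc _} _   = s≤s z≤n

x-1≤j⇒x≤1+j : ∀ x j → + x - + 1 ℤ.≤ + j → x ≤ suc j
x-1≤j⇒x≤1+j zero    j _           = z≤n
x-1≤j⇒x≤1+j (suc x) j (ℤ.+≤+ x≤j) = s≤s x≤j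

x≤1+j⇒x-1≤j : ∀ x j → x ≤ suc j → + x - + 1 ℤ.≤ + j
x≤1+j⇒x-1≤j zero    j _         = ℤ.-≤+
x≤1+j⇒x-1≤j (suc x) j (s≤s x≤j) = ℤ.+≤+ x≤j

x-1≤-1⇒x≡0 : ∀ x → + x - + 1 ℤ.≤ ℤ.-1ℤ → x ≡ 0
x-1≤-1⇒x≡0 zero    _ = refl
x-1≤-1⇒x≡0 (suc x) ()

-- h_{-1} is -1 for n = 2 and 0 for n > 2; for n = 2 the elements of 𝓑 have WD = 0 or deg = 0.
lev₋₁≤-1⇒dg≡0 : ∀ m (b : RawB (suc (suc m))) → InB b → lev ℤ.-1ℤ b ℤ.≤ ℤ.-1ℤ → dg b ≡ 0
lev₋₁≤-1⇒dg≡0 (suc zero)    b _ lev≤ = x-1≤-1⇒x≡0 (dg b) lev≤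
lev₋₁≤-1⇒dg≡0 (suc (suc m)) b _ lev≤ = x-1≤-1⇒x≡0 (dg b) lev≤
lev₋₁≤-1⇒dg≡0 zero (zero , Λ) inB _ = n≤0⇒n≡0 (≤-trans (deg≤wtFrom 0 Λ) (InB⇒wt≤k*deg zero Λ inB))
lev₋₁≤-1⇒dg≡0 zero b@(suc zero , Λ) inB lev≤ =
  x-1≤-1⇒x≡0 (deg Λ) (subst (λ w → ℤ.-1ℤ ℤ.* w ℤ.+ + deg Λ - + 1 ℤ.≤ ℤ.-1ℤ) (trans (WD≡wd b) (cong +_ wd≡0)) lev≤)
  where wd≡0 : wd b ≡ 0
        wd≡0 = trans (+-identityʳ (wt Λ ∸ deg Λ))
                     (m≤n⇒m∸n≡0 (≤-trans (InB⇒wt≤k*deg (suc zero) Λ inB) (≤-reflexive (*-identityˡ (deg Λ)))))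

dg≡0⇒lev₋₁≤-1 : ∀ m (b : RawB (suc (suc m))) → dg b ≡ 0 → lev ℤ.-1ℤ b ℤ.≤ ℤ.-1ℤ
dg≡0⇒lev₋₁≤-1 (suc zero)    b dg≡0 rewrite dg≡0 = ℤP.≤-refl
dg≡0⇒lev₋₁≤-1 (suc (suc m)) b dg≡0 rewrite dg≡0 = ℤP.≤-refl
dg≡0⇒lev₋₁≤-1 zero          b dg≡0 rewrite WD≡wd b =
  subst (λ d → ℤ.-1ℤ ℤ.* + wd b ℤ.+ + d - + 1 ℤ.≤ ℤ.-1ℤ) (sym dg≡0) (-wd-1≤-1 (wd b))
  where -wd-1≤-1 : ∀ w → ℤ.-1ℤ ℤ.* + w ℤ.+ + 0 - + 1 ℤ.≤ ℤ.-1ℤ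
        -wd-1≤-1 zero    = ℤP.≤-refl
        -wd-1≤-1 (suc w) = ℤ.-≤- z≤n

module _ (m : ℕ) where

  private
    M n : ℕ
    M = suc m
    n = suc M

    Basis : Set
    Basis = RawB n

    codim : Fin n → ℕ
    codim t = n ∸ suc (toℕ t)

    codim+t≡M : ∀ (t : Fin n) → codim t + toℕ t ≡ M
    codim+t≡M t = m∸n+n≡m (≤-pred (toℕ<n t))

  -- h j = ⌈j / M⌉ is the paper's h_j for j ≥ 0
  h : ℕ → ℕ
  h zero    = 0
  h (suc j) = j / M + 1

  j≤h[j]*M : ∀ j → j ≤ h j * M
  j≤h[j]*M zero    = z≤n
  j≤h[j]*M (suc j) = begin
    suc j                       ≡⟨ cong suc (m≡m%n+[m/n]*n j M) ⟩
    suc (j % M + (j / M) * M)   ≤⟨ s≤s (+-monoˡ-≤ ((j / M) * M) (<⇒≤pred (m%n<n j M))) ⟩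
    suc (m + (j / M) * M)       ≡⟨ +-comm M ((j / M) * M) ⟩
    (j / M) * M + M             ≡⟨ distrib (j / M) M ⟨
    (j / M + 1) * M             ∎
    where open ≤-Reasoning
          distrib : ∀ a b → (a + 1) * b ≡ a * b + b
          distrib = solve-∀

  h[j]*M≤j+m : ∀ j → h j * M ≤ j + m
  h[j]*M≤j+m zero    = z≤n
  h[j]*M≤j+m (suc j) = begin
    (j / M + 1) * M     ≡⟨ distrib (j / M) m ⟩
    (j / M) * M + m + 1 ≤⟨ +-monoˡ-≤ 1 (+-monoˡ-≤ m (m/n*n≤m j M)) ⟩
    j + m + 1           ≡⟨ +-comm (j + m) 1 ⟩
    suc j + m           ∎
    where open ≤-Reasoning
          distrib : ∀ a b → (a + 1) * suc b ≡ a * suc b + b + 1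
          distrib = solve-∀

  h-mono : ∀ {i j} → i ≤ j → h i ≤ h j
  h-mono {zero}            _         = z≤n
  h-mono {suc i} {suc j} (s≤s i≤j) = +-monoˡ-≤ 1 (/-monoˡ-≤ M i≤j)

  h-least : ∀ j c → j ≤ c * M → h j ≤ c
  h-least j c j≤cM = ≤-pred (*-cancelʳ-< M (h j) (suc c) (begin-strict
    h j * M   ≤⟨ h[j]*M≤j+m j ⟩
    j + m     ≤⟨ +-monoˡ-≤ m j≤cM ⟩
    c * M + m <⟨ +-monoʳ-< (c * M) (n<1+n m) ⟩
    c * M + M ≡⟨ +-comm (c * M) M ⟩
    suc c * M ∎))
    where open ≤-Reasoning

  -- For i ≥ 0, b ∈ 𝓝 i iff b ∈ 𝓑 and LevelWithin i (WD b) (deg b), since lev_j b ≤ j reads h_j WD + deg ≤ j + 1.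
  LevelWithin : ℕ → ℕ → ℕ → Set
  LevelWithin i W d = ∃[ j ] j ≤ i × h j * W + d ≤ suc j

  LevelWithin-deg≤1 : ∀ i W {d} → d ≤ 1 → LevelWithin i W d
  LevelWithin-deg≤1 i W d≤1 = 0 , z≤n , d≤1

  LevelWithin-zero⇒deg≤1 : ∀ {W d} → LevelWithin 0 W d → d ≤ 1
  LevelWithin-zero⇒deg≤1 (zero , z≤n , d≤1) = d≤1

  LevelWithin⇒W<M : ∀ {i W d} → LevelWithin i W d → 2 ≤ d → W < M
  LevelWithin⇒W<M {W = W} {d} (j , _ , bound) d≥2 =
    *-cancelˡ-< (h j) W M (+-cancelʳ-< 1 (h j * W) (h j * M) (begin-strict
      h j * W + 1     <⟨ +-monoʳ-< (h j * W) (s≤s (s≤s z≤n)) ⟩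
      h j * W + 2     ≤⟨ +-monoʳ-≤ (h j * W) d≥2 ⟩
      h j * W + d     ≤⟨ bound ⟩
      suc j           ≤⟨ s≤s (j≤h[j]*M j) ⟩
      suc (h j * M)   ≡⟨ +-comm 1 (h j * M) ⟩
      h j * M + 1     ∎))
    where open ≤-Reasoning

  deg≤h*slack+1 : ∀ {j W d a} → h j * W + d ≤ suc j → W + a ≡ M → d ≤ h j * a + 1
  deg≤h*slack+1 {j} {W} {d} {a} bound W+a≡M = +-cancelˡ-≤ (h j * W) _ _ (begin
    h j * W + d             ≤⟨ bound ⟩
    suc j                   ≤⟨ s≤s (j≤h[j]*M j) ⟩
    suc (h j * M)           ≡⟨ cong (λ z → suc (h j * z)) (sym W+a≡M) ⟩
    suc (h j * (W + a))     ≡⟨ distrib (h j) W a ⟩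
    h j * W + (h j * a + 1) ∎)
    where open ≤-Reasoning
          distrib : ∀ x y z → suc (x * (y + z)) ≡ x * y + (x * z + 1)
          distrib = solve-∀

  LevelWithin-pred : ∀ {J Wb Wx db dx} → LevelWithin (suc J) Wb db → Wx ≤ Wb → dx + 1 ≡ db →
                     LevelWithin J Wx dx
  LevelWithin-pred {dx = dx} (zero , _ , db≤1) _ dx+1≡db =
    0 , z≤n , ≤-trans (m≤m+n dx 1) (≤-trans (≤-reflexive dx+1≡db) db≤1)
  LevelWithin-pred {J} {Wb} {Wx} {db} {dx} (suc j , s≤s j≤J , bound) Wx≤Wb dx+1≡db =
    j , j≤J , +-cancelʳ-≤ 1 _ _ (begin
      h j * Wx + dx + 1         ≡⟨ +-assoc (h j * Wx) dx 1 ⟩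
      h j * Wx + (dx + 1)       ≤⟨ +-mono-≤ (*-mono-≤ (h-mono (n≤1+n j)) Wx≤Wb) (≤-reflexive dx+1≡db) ⟩
      h (suc j) * Wb + db       ≤⟨ bound ⟩
      suc (suc j)               ≡⟨ +-comm 1 (suc j) ⟩
      suc j + 1                 ∎)
    where open ≤-Reasoning

  private
    slack-transfer : ∀ {Wb Wc Wx a} → Wc + a ≡ M → Wx + M ≡ Wb + Wc → Wx + a ≡ Wb
    slack-transfer {Wb} {Wc} {Wx} {a} Wc+a≡M eW = +-cancelʳ-≡ Wc _ _ (begin
      Wx + a + Wc   ≡⟨ +-assoc Wx a Wc ⟩
      Wx + (a + Wc) ≡⟨ cong (_+_ Wx) (trans (+-comm a Wc) Wc+a≡M) ⟩
      Wx + M        ≡⟨ eW ⟩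
      Wb + Wc       ∎)
      where open ≡-Reasoning

    bracket-bound-≤ : ∀ {j₁ j₂ Wb Wc Wx db dc dx a} → h j₁ ≤ h j₂ →
                      h j₁ * Wb + db ≤ suc j₁ → h j₂ * Wc + dc ≤ suc j₂ → Wb + a ≡ M →
                      Wx + M ≡ Wb + Wc → dx + 1 ≡ db + dc → h j₂ * Wx + dx ≤ suc j₂
    bracket-bound-≤ {j₁} {j₂} {Wb} {Wc} {Wx} {db} {dc} {dx} {a} h₁≤h₂ bound-b bound-c Wb+a≡M eW ed =
      +-cancelʳ-≤ 1 _ _ (begin
        h₂ * Wx + dx + 1            ≡⟨ +-assoc (h₂ * Wx) dx 1 ⟩
        h₂ * Wx + (dx + 1)          ≡⟨ cong (_+_ (h₂ * Wx)) ed ⟩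
        h₂ * Wx + (db + dc)         ≤⟨ +-monoʳ-≤ (h₂ * Wx) (+-monoˡ-≤ dc db≤) ⟩
        h₂ * Wx + (h₂ * a + 1 + dc) ≡⟨ rearrange h₂ Wx a dc ⟩
        h₂ * (Wx + a) + dc + 1      ≡⟨ cong (λ z → h₂ * z + dc + 1) (slack-transfer Wb+a≡M (trans eW (+-comm Wb Wc))) ⟩
        h₂ * Wc + dc + 1            ≤⟨ +-monoˡ-≤ 1 bound-c ⟩
        suc j₂ + 1                  ∎)
      where
        open ≤-Reasoning
        h₂ = h j₂
        db≤ : db ≤ h₂ * a + 1
        db≤ = ≤-trans (deg≤h*slack+1 bound-b Wb+a≡M) (+-monoˡ-≤ 1 (*-monoˡ-≤ a h₁≤h₂))
        rearrange : ∀ h w p d → h * w + (h * p + 1 + d) ≡ h * (w + p) + d + 1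
        rearrange = solve-∀

    bracket-bound-> : ∀ {j₁ j₂ j₃ Wb Wc Wx db dc dx a} → h j₂ < h j₁ → a + j₃ ≡ j₁ →
                      h j₁ * Wb + db ≤ suc j₁ → h j₂ * Wc + dc ≤ suc j₂ → Wc + a ≡ M →
                      Wx + M ≡ Wb + Wc → dx + 1 ≡ db + dc → h j₃ * Wx + dx ≤ suc j₃
    bracket-bound-> {j₁} {j₂} {j₃} {Wb} {Wc} {Wx} {db} {dc} {dx} {a} h₂<h₁ a+j₃≡j₁ bound-b bound-c Wc+a≡M eW ed =
      +-cancelʳ-≤ (1 + a) _ _ (begin
        h₃ * Wx + dx + (1 + a)              ≡⟨ shift-1 (h₃ * Wx) dx a ⟩
        h₃ * Wx + (dx + 1) + a              ≡⟨ cong (λ z → h₃ * Wx + z + a) ed ⟩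
        h₃ * Wx + (db + dc) + a             ≤⟨ +-monoˡ-≤ a (+-mono-≤ (*-monoˡ-≤ Wx h₃≤h₁) (+-monoʳ-≤ db dc≤)) ⟩
        h₁ * Wx + (db + (h₂ * a + 1)) + a   ≡⟨ collect h₁ Wx db h₂ a ⟩
        h₁ * Wx + db + suc h₂ * a + 1       ≤⟨ +-monoˡ-≤ 1 (+-monoʳ-≤ (h₁ * Wx + db) (*-monoˡ-≤ a h₂<h₁)) ⟩
        h₁ * Wx + db + h₁ * a + 1           ≡⟨ factor h₁ Wx db a ⟩
        h₁ * (Wx + a) + db + 1              ≡⟨ cong (λ z → h₁ * z + db + 1) (slack-transfer Wc+a≡M eW) ⟩
        h₁ * Wb + db + 1                    ≤⟨ +-monoˡ-≤ 1 bound-b ⟩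
        suc j₁ + 1                          ≡⟨ cong (λ z → suc z + 1) (sym a+j₃≡j₁) ⟩
        suc (a + j₃) + 1                    ≡⟨ unshift j₃ a ⟩
        suc j₃ + (1 + a)                    ∎)
      where
        open ≤-Reasoning
        h₁ = h j₁
        h₂ = h j₂
        h₃ = h j₃
        h₃≤h₁ : h₃ ≤ h₁
        h₃≤h₁ = h-mono (subst (j₃ ≤_) a+j₃≡j₁ (m≤n+m j₃ a))
        dc≤ : dc ≤ h₂ * a + 1
        dc≤ = deg≤h*slack+1 bound-c Wc+a≡M
        shift-1 : ∀ x d a → x + d + (1 + a) ≡ x + (d + 1) + a
        shift-1 = solve-∀
        collect : ∀ h w d g a → h * w + (d + (g * a + 1)) + a ≡ h * w + d + suc g * a + 1
        collect = solve-∀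
        factor : ∀ h w d a → h * w + d + h * a + 1 ≡ h * (w + a) + d + 1
        factor = solve-∀
        unshift : ∀ j a → suc (a + j) + 1 ≡ suc j + (1 + a)
        unshift = solve-∀

    bracket-bound-degenerate : ∀ {j₁ j₂ Wb Wc Wx db dc dx a} → h j₂ < h j₁ → j₁ < a →
                               h j₁ * Wb + db ≤ suc j₁ → h j₂ * Wc + dc ≤ suc j₂ → Wc + a ≡ M →
                               Wx + M ≡ Wb + Wc → dx + 1 ≡ db + dc → dx ≤ 1
    bracket-bound-degenerate {j₁} {j₂} {Wb} {Wc} {Wx} {db} {dc} {dx} {a} h₂<h₁ j₁<a bound-b bound-c Wc+a≡M eW ed =
      +-cancelʳ-≤ 1 dx 1 (begin
        dx + 1  ≡⟨ ed ⟩
        db + dc ≡⟨ cong (_+ dc) db≡0 ⟩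
        dc      ≤⟨ dc≤1 ⟩
        1       ≤⟨ n≤1+n 1 ⟩
        2       ∎)
      where
        open ≤-Reasoning
        h₁ = h j₁
        h₂ = h j₂
        h₁≤1 : h₁ ≤ 1
        h₁≤1 = ≤-pred (*-cancelʳ-< M h₁ 2 (begin-strict
          h₁ * M ≤⟨ h[j]*M≤j+m j₁ ⟩
          j₁ + m <⟨ +-monoˡ-< m j₁<a ⟩
          a + m  ≤⟨ +-monoˡ-≤ m (subst (a ≤_) Wc+a≡M (m≤n+m a Wc)) ⟩
          M + m  <⟨ +-monoʳ-< M (n<1+n m) ⟩
          M + M  ≡⟨ cong (_+_ M) (+-identityʳ M) ⟨
          2 * M  ∎))
        h₂≡0 : h₂ ≡ 0
        h₂≡0 = n≤0⇒n≡0 (≤-pred (≤-trans h₂<h₁ h₁≤1))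
        h₁≡1 : h₁ ≡ 1
        h₁≡1 = ≤-antisym h₁≤1 (≤-trans (s≤s z≤n) h₂<h₁)
        dc≤1 : dc ≤ 1
        dc≤1 = ≤-trans (deg≤h*slack+1 bound-c Wc+a≡M) (≤-reflexive (cong (λ z → z * a + 1) h₂≡0))
        db≡0 : db ≡ 0
        db≡0 = n≤0⇒n≡0 (+-cancelˡ-≤ Wb db 0 (begin
          Wb + db      ≡⟨ cong (_+ db) (*-identityˡ Wb) ⟨
          1 * Wb + db  ≡⟨ cong (λ z → z * Wb + db) h₁≡1 ⟨
          h₁ * Wb + db ≤⟨ bound-b ⟩
          suc j₁       ≤⟨ j₁<a ⟩
          a            ≤⟨ m≤n+m a Wx ⟩
          Wx + a       ≡⟨ slack-transfer Wc+a≡M eW ⟩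
          Wb           ≡⟨ +-identityʳ Wb ⟨
          Wb + 0       ∎))

  -- If h_{j₁} ≤ h_{j₂}, the witness j₂ for c also works for x; otherwise the witness j₁ for b,
  -- lowered by a = M - WD c, does (or a > j₁, which forces deg x = 0).
  LevelWithin-bracket : ∀ {J Wb Wc Wx db dc dx} →
                        LevelWithin (suc J) Wb db → LevelWithin J Wc dc → Wb ≤ M → Wc < M →
                        Wx + M ≡ Wb + Wc → dx + 1 ≡ db + dc → LevelWithin J Wx dx
  LevelWithin-bracket {J} {Wc = Wc} (j₁ , j₁≤ , bound-b) (j₂ , j₂≤ , bound-c) Wb≤M Wc<M eW ed
    with h j₁ ≤? h j₂
  ... | yes h₁≤h₂ = j₂ , j₂≤ , bracket-bound-≤ h₁≤h₂ bound-b bound-c (proj₂ (m≤n⇒∃[o]m+o≡n Wb≤M)) eW ed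
  ... | no h₁≰h₂ with m≤n⇒∃[o]m+o≡n Wc<M
  ...   | a′ , Wc+1+a′≡M with suc a′ ≤? j₁
  ...     | yes a≤j₁ = j₃ , j₃≤J , bracket-bound-> (≰⇒> h₁≰h₂) a+j₃≡j₁ bound-b bound-c Wc+a≡M eW ed
    where
      Wc+a≡M = trans (+-suc Wc a′) Wc+1+a′≡M
      j₃ = proj₁ (m≤n⇒∃[o]m+o≡n a≤j₁)
      a+j₃≡j₁ = proj₂ (m≤n⇒∃[o]m+o≡n a≤j₁)
      j₃≤J : j₃ ≤ J
      j₃≤J = ≤-pred (≤-trans (s≤s (m≤n+m j₃ a′)) (≤-trans (≤-reflexive a+j₃≡j₁) j₁≤))
  ...     | no a≰j₁ = 0 , z≤n ,
    bracket-bound-degenerate (≰⇒> h₁≰h₂) (≰⇒> a≰j₁) bound-b bound-c (trans (+-suc Wc a′) Wc+1+a′≡M) eW ed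

  LevelWithin-probe : ∀ j → LevelWithin j m (suc (j / M))
  LevelWithin-probe j = (j / M) * M , m/n*n≤m j M , (begin
    h ((j / M) * M) * m + suc (j / M) ≤⟨ +-monoˡ-≤ (suc (j / M)) (*-monoˡ-≤ m (h-least _ (j / M) ≤-refl)) ⟩
    (j / M) * m + suc (j / M)         ≡⟨ collect (j / M) m ⟩
    suc ((j / M) * M)                 ∎)
    where open ≤-Reasoning
          collect : ∀ c m → c * m + suc c ≡ suc (c * suc m)
          collect = solve-∀

  LevelWithin-unbracket : ∀ j {Wb Wx db dx} → LevelWithin j Wx dx → Wx + 1 ≡ Wb → dx ≡ db + j / M →
                          LevelWithin (suc j) Wb db
  LevelWithin-unbracket j {Wb} {Wx} {db} {dx} (j₃ , j₃≤j , bound) Wx+1≡Wb dx≡ with h j₃ ≤? j / M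
  ... | yes h₃≤c = j₃ , m≤n⇒m≤1+n j₃≤j , (begin
    h j₃ * Wb + db             ≡⟨ cong (λ z → h j₃ * z + db) Wx+1≡Wb ⟨
    h j₃ * (Wx + 1) + db       ≡⟨ distrib (h j₃) Wx db ⟩
    h j₃ * Wx + (db + h j₃)    ≤⟨ +-monoʳ-≤ (h j₃ * Wx) (+-monoʳ-≤ db h₃≤c) ⟩
    h j₃ * Wx + (db + j / M)   ≡⟨ cong (_+_ (h j₃ * Wx)) dx≡ ⟨
    h j₃ * Wx + dx             ≤⟨ bound ⟩
    suc j₃                     ∎)
    where open ≤-Reasoning
          distrib : ∀ h w d → h * (w + 1) + d ≡ h * w + (d + h)
          distrib = solve-∀
  ... | no h₃≰c = suc j₃ , s≤s j₃≤j , +-cancelʳ-≤ 1 _ _ (begin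
    h (suc j₃) * Wb + db + 1       ≤⟨ +-monoˡ-≤ 1 (+-monoˡ-≤ db (*-monoˡ-≤ Wb h[1+j₃]≤h₃)) ⟩
    h j₃ * Wb + db + 1             ≡⟨ cong (λ z → h j₃ * z + db + 1) Wx+1≡Wb ⟨
    h j₃ * (Wx + 1) + db + 1       ≡⟨ cong (λ z → z * (Wx + 1) + db + 1) h₃≡ ⟩
    (j / M + 1) * (Wx + 1) + db + 1 ≡⟨ distrib (j / M) Wx db ⟩
    (j / M + 1) * Wx + (db + j / M) + 1 + 1 ≡⟨ cong (λ z → z * Wx + (db + j / M) + 1 + 1) h₃≡ ⟨
    h j₃ * Wx + (db + j / M) + 1 + 1 ≡⟨ cong (λ z → h j₃ * Wx + z + 1 + 1) dx≡ ⟨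
    h j₃ * Wx + dx + 1 + 1         ≤⟨ +-monoˡ-≤ 1 (+-monoˡ-≤ 1 bound) ⟩
    suc j₃ + 1 + 1                 ≡⟨ cong (_+ 1) (+-comm (suc j₃) 1) ⟩
    suc (suc j₃) + 1               ∎)
    where
      open ≤-Reasoning
      j<h[1+j]*M : j < h (suc j) * M
      j<h[1+j]*M = j≤h[j]*M (suc j)
      h₃≡ : h j₃ ≡ j / M + 1
      h₃≡ = ≤-antisym (h-least j₃ (j / M + 1) (≤-trans j₃≤j (<⇒≤ j<h[1+j]*M)))
                      (≤-trans (≤-reflexive (+-comm (j / M) 1)) (≰⇒> h₃≰c))
      h[1+j₃]≤h₃ : h (suc j₃) ≤ h j₃
      h[1+j₃]≤h₃ = ≤-trans (h-least (suc j₃) (j / M + 1) (≤-trans (s≤s j₃≤j) j<h[1+j]*M)) (≤-reflexive (sym h₃≡))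
      distrib : ∀ c w d → (c + 1) * (w + 1) + d + 1 ≡ (c + 1) * w + (d + c) + 1 + 1
      distrib = solve-∀

  LevelWithin-unbracket-WD0 : ∀ j {Wx db dx} → LevelWithin j Wx dx → dx + 1 ≡ db → LevelWithin (suc j) 0 db
  LevelWithin-unbracket-WD0 j {Wx} {db} {dx} (j₃ , j₃≤j , bound) dx+1≡db = suc j₃ , s≤s j₃≤j , (begin
    h (suc j₃) * 0 + db ≡⟨ cong (_+ db) (*-zeroʳ (h (suc j₃))) ⟩
    db                  ≡⟨ dx+1≡db ⟨
    dx + 1              ≤⟨ +-monoˡ-≤ 1 (≤-trans (m≤n+m dx _) bound) ⟩
    suc j₃ + 1          ≡⟨ +-comm (suc j₃) 1 ⟩
    suc (suc j₃)        ∎)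
    where open ≤-Reasoning

  hgt≡h : ∀ j → hgt n (+ j) ≡ + h j
  hgt≡h (suc j) = refl
  hgt≡h zero = hgt[0]≡0 m
    where hgt[0]≡0 : ∀ m → hgt (suc (suc m)) (+ 0) ≡ + 0
          hgt[0]≡0 zero    = refl
          hgt[0]≡0 (suc _) = refl

  lev≡ : ∀ j (b : Basis) → lev (+ j) b ≡ + (h j * wd b + dg b) - + 1
  lev≡ j b rewrite hgt≡h j | WD≡wd b | sym (ℤP.pos-* (h j) (wd b)) | sym (ℤP.pos-+ (h j * wd b) (dg b)) = refl

  𝓝⇒LevelWithin : ∀ i (b : Basis) → 𝓝 n (+ i) b → LevelWithin i (wd b) (dg b)
  𝓝⇒LevelWithin i b (_ , + j , _ , j≤i , lev≤) =
    j , ℤP.drop‿+≤+ j≤i , x-1≤j⇒x≤1+j _ j (subst (ℤ._≤ + j) (lev≡ j b) lev≤)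
  𝓝⇒LevelWithin i b (inB , ℤ.-[1+ 0 ] , _ , _ , lev≤) rewrite lev₋₁≤-1⇒dg≡0 m b inB lev≤ = 0 , z≤n , z≤n
  𝓝⇒LevelWithin i b (_ , ℤ.-[1+ suc _ ] , ℤ.-≤- () , _)

  LevelWithin⇒𝓝 : ∀ i (b : Basis) → InB b → LevelWithin i (wd b) (dg b) → 𝓝 n (+ i) b
  LevelWithin⇒𝓝 i b inB (j , j≤i , bound) =
    inB , + j , ℤ.-≤+ , ℤ.+≤+ j≤i , subst (ℤ._≤ + j) (sym (lev≡ j b)) (x≤1+j⇒x-1≤j _ j bound)

  dg≤1⇒𝓝 : ∀ i (b : Basis) → InB b → dg b ≤ 1 → 𝓝 n (+ i) b
  dg≤1⇒𝓝 i b inB dg≤1 = LevelWithin⇒𝓝 i b inB (LevelWithin-deg≤1 i (wd b) dg≤1)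

  𝓝₋₁⇒dg≡0 : (b : Basis) → 𝓝 n ℤ.-1ℤ b → dg b ≡ 0
  𝓝₋₁⇒dg≡0 b (inB , ℤ.-[1+ 0 ] , _ , _ , lev≤)  = lev₋₁≤-1⇒dg≡0 m b inB lev≤
  𝓝₋₁⇒dg≡0 b (_ , ℤ.-[1+ suc _ ] , ℤ.-≤- () , _)
  𝓝₋₁⇒dg≡0 b (_ , + _ , _ , () , _)

  dg≡0⇒𝓝₋₁ : (b : Basis) → InB b → dg b ≡ 0 → 𝓝 n ℤ.-1ℤ b
  dg≡0⇒𝓝₋₁ b inB dg≡0 = inB , ℤ.-1ℤ , ℤP.≤-refl , ℤP.≤-refl , dg≡0⇒lev₋₁≤-1 m b dg≡0

  dg≡0⇒wd≤M : (b : Basis) → dg b ≡ 0 → wd b ≤ M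
  dg≡0⇒wd≤M (k , Λ) dg≡0 rewrite deg≡0⇒wtFrom≡0 1 Λ dg≡0 | dg≡0 = ∸-monoʳ-≤ {n = suc (toℕ k)} n (s≤s z≤n)

  dg≡1⇒wd≤m : (b : Basis) → InB b → dg b ≡ 1 → wd b ≤ m
  dg≡1⇒wd≤m (k , Λ) inB dg≡1 with toℕ k in k≡ | InB⇒wt≤k*deg k Λ inB
  ... | zero   | wt≤0 = ⊥-elim (1+n≰n (begin
    1               ≡⟨ dg≡1 ⟨
    deg Λ           ≤⟨ deg≤wtFrom 0 Λ ⟩
    wt Λ            ≤⟨ wt≤0 ⟩
    0 * deg Λ       ≡⟨⟩
    0               ∎))
    where open ≤-Reasoning
  ... | suc k′ | wt≤ = begin
    excess Λ + (n ∸ suc (suc k′)) ≤⟨ +-monoˡ-≤ (m ∸ k′) (∸-monoˡ-≤ (deg Λ) wt≤1+k′) ⟩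
    (suc k′ ∸ deg Λ) + (m ∸ k′)   ≡⟨ cong (λ d → (suc k′ ∸ d) + (m ∸ k′)) dg≡1 ⟩
    k′ + (m ∸ k′)                 ≡⟨ m+[n∸m]≡n k′≤m ⟩
    m                             ∎
    where open ≤-Reasoning
          wt≤1+k′ : wt Λ ≤ suc k′
          wt≤1+k′ = ≤-trans wt≤ (≤-reflexive (trans (cong (suc k′ *_) dg≡1) (*-identityʳ (suc k′))))
          k′≤m : k′ ≤ m
          k′≤m = ≤-pred (≤-pred (subst (_< n) k≡ (toℕ<n k)))

  LevelWithin⇒wd≤M : ∀ {i} (b : Basis) → InB b → LevelWithin i (wd b) (dg b) → wd b ≤ M
  LevelWithin⇒wd≤M b inB lw = by-degree (dg b) refl
    where by-degree : ∀ d → dg b ≡ d → wd b ≤ M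
          by-degree zero          dg≡ = dg≡0⇒wd≤M b dg≡
          by-degree (suc zero)    dg≡ = ≤-trans (dg≡1⇒wd≤m b inB dg≡) (n≤1+n m)
          by-degree (suc (suc _)) dg≡ = <⇒≤ (LevelWithin⇒W<M lw (subst (2 ≤_) (sym dg≡) (s≤s (s≤s z≤n))))

  LevelWithin⇒wd<M : ∀ {i} (c : Basis) → InB c → 1 ≤ dg c → LevelWithin i (wd c) (dg c) → wd c < M
  LevelWithin⇒wd<M c inB dg≥1 lw = by-degree (dg c) refl dg≥1
    where by-degree : ∀ d → dg c ≡ d → 1 ≤ d → wd c < M
          by-degree (suc zero)    dg≡ _ = s≤s (dg≡1⇒wd≤m c inB dg≡)
          by-degree (suc (suc _)) dg≡ _ = LevelWithin⇒W<M lw (subst (2 ≤_) (sym dg≡) (s≤s (s≤s z≤n)))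

  record BracketTerm (b c x : Basis) : Set where
    field
      inB        : InB x
      wd-bracket : wd x + M ≡ wd b + wd c
      dg-bracket : dg x + 1 ≡ dg b + dg c

  private
    wd-rearrange : ∀ e t e₁ e₂ P Q → e + t ≡ e₁ + e₂ → e + P + (Q + t) ≡ (e₁ + P) + (e₂ + Q)
    wd-rearrange e t e₁ e₂ P Q e+t≡ = begin
      e + P + (Q + t)     ≡⟨ regroup e P Q t ⟩
      (e + t) + P + Q     ≡⟨ cong (λ z → z + P + Q) e+t≡ ⟩
      (e₁ + e₂) + P + Q   ≡⟨ regroup′ e₁ e₂ P Q ⟩
      (e₁ + P) + (e₂ + Q) ∎
      where open ≡-Reasoning
            regroup : ∀ a b c d → a + b + (c + d) ≡ (a + d) + b + c
            regroup = solve-∀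
            regroup′ : ∀ a b c d → (a + b) + c + d ≡ (a + c) + (b + d)
            regroup′ = solve-∀

  bracket-term-< : ∀ {k u : Fin n} Λ Θ → toℕ u < toℕ k → InB (k , Λ) → InB (u , Θ) → 1 ≤ lookup Λ u →
                   BracketTerm (k , Λ) (u , Θ) (k , mul (decAt u Λ) Θ)
  bracket-term-< {k} {u} Λ Θ u<k Λ∈ Θ∈ Λu≥1 = record
    { inB        = InB-mul-decAt {k = k} {u} {Λ} {Θ} Λ∈ (InB-weaken {k = u} {k} {Θ} (<⇒≤ u<k) Θ∈)
    ; wd-bracket = trans (cong (_+_ (wd (k , X))) (sym (codim+t≡M u)))
                         (wd-rearrange (excess X) (toℕ u) (excess Λ) (excess Θ) (codim k) (codim u)
                                       (excess-mul-decAt Λ Θ u Λu≥1))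
    ; dg-bracket = deg-mul-decAt Λ Θ u Λu≥1
    }
    where X = mul (decAt u Λ) Θ

  bracket-term-> : ∀ {k u : Fin n} Λ Θ → toℕ k < toℕ u → InB (k , Λ) → InB (u , Θ) → 1 ≤ lookup Θ k →
                   BracketTerm (k , Λ) (u , Θ) (u , mul Λ (decAt k Θ))
  bracket-term-> {k} {u} Λ Θ k<u Λ∈ Θ∈ Θk≥1 = subst (λ X → BracketTerm (k , Λ) (u , Θ) (u , X)) (mul-comm _ _) (record
    { inB        = InB-mul-decAt {k = u} {k} {Θ} {Λ} Θ∈ (InB-weaken {k = k} {u} {Λ} (<⇒≤ k<u) Λ∈)
    ; wd-bracket = trans (cong (_+_ (wd (u , X))) (sym (codim+t≡M k)))
                         (trans (wd-rearrange (excess X) (toℕ k) (excess Θ) (excess Λ) (codim u) (codim k)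
                                              (excess-mul-decAt Θ Λ k Θk≥1))
                                (+-comm (excess Θ + codim u) (excess Λ + codim k)))
    ; dg-bracket = trans (deg-mul-decAt Θ Λ k Θk≥1) (+-comm (deg Θ) (deg Λ))
    })
    where X = mul (decAt k Θ) Λ

  bracket-terms : ∀ (b c : Basis) → InB b → InB c →
                  All (λ t → proj₁ t ≢ + 0 → BracketTerm b c (proj₂ t)) (bracket b c)
  bracket-terms (k , Λ) (u , Θ) Λ∈ Θ∈ with <-cmp (toℕ u) (toℕ k)
  ... | tri< u<k _ _ = (λ z≢0 → bracket-term-< Λ Θ u<k Λ∈ Θ∈ (+a≢0⇒1≤a z≢0)) ∷ []
  ... | tri≈ _ _ _   = []
  ... | tri> _ _ k<u = (λ z≢0 → bracket-term-> Λ Θ k<u Λ∈ Θ∈ (-a≢0⇒1≤a z≢0)) ∷ []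

  bracket-preserves-𝓝 : ∀ j {b c x : Basis} → 𝓝 n (+ j) b → 𝓝 n (+ j - + 1) c → BracketTerm b c x →
                        𝓝 n (+ j - + 1) x
  bracket-preserves-𝓝 zero {b} {c} {x} b∈ c∈ x∈[b,c] = dg≡0⇒𝓝₋₁ x inB dx≡0
    where
      open BracketTerm x∈[b,c]
      db≤1 = LevelWithin-zero⇒deg≤1 (𝓝⇒LevelWithin 0 b b∈)
      dx≡0 : dg x ≡ 0
      dx≡0 = n≤0⇒n≡0 (+-cancelʳ-≤ 1 (dg x) 0 (begin
        dg x + 1      ≡⟨ dg-bracket ⟩
        dg b + dg c   ≡⟨ cong (_+_ (dg b)) (𝓝₋₁⇒dg≡0 c c∈) ⟩
        dg b + 0      ≡⟨ +-identityʳ (dg b) ⟩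
        dg b          ≤⟨ db≤1 ⟩
        1             ∎))
        where open ≤-Reasoning
  bracket-preserves-𝓝 (suc J) {b} {c} {x} b∈ c∈ x∈[b,c] = LevelWithin⇒𝓝 J x inB (by-degree (dg c) refl)
    where
      open BracketTerm x∈[b,c]
      lb = 𝓝⇒LevelWithin (suc J) b b∈
      lc = 𝓝⇒LevelWithin J c c∈
      by-degree : ∀ d → dg c ≡ d → LevelWithin J (wd x) (dg x)
      by-degree zero dc≡0 = LevelWithin-pred lb wx≤wb dx+1≡db
        where
          wx≤wb : wd x ≤ wd b
          wx≤wb = +-cancelʳ-≤ M (wd x) (wd b)
            (≤-trans (≤-reflexive wd-bracket) (+-monoʳ-≤ (wd b) (dg≡0⇒wd≤M c dc≡0)))
          dx+1≡db : dg x + 1 ≡ dg b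
          dx+1≡db = trans dg-bracket (trans (cong (_+_ (dg b)) dc≡0) (+-identityʳ (dg b)))
      by-degree (suc _) dc≡ =
        LevelWithin-bracket lb lc (LevelWithin⇒wd≤M b (proj₁ b∈) lb)
                            (LevelWithin⇒wd<M c (proj₁ c∈) (subst (1 ≤_) (sym dc≡) (s≤s z≤n)) lc)
                            wd-bracket dg-bracket

  𝓝⇒Normalizer : ∀ j (b : Basis) → 𝓝 n (+ j) b → Normalizer (𝓝 n (+ j - + 1)) b
  𝓝⇒Normalizer j b b∈ = proj₁ b∈ , λ c c∈ →
    InSpan-support (All.map (λ x∈[b,c] z≢0 → bracket-preserves-𝓝 j b∈ c∈ (x∈[b,c] z≢0))
                            (bracket-terms b c (proj₁ b∈) (proj₁ c∈)))

  ∂ : Fin n → Basis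
  ∂ u = u , zeros

  InB-∂ : ∀ u → InB (∂ u)
  InB-∂ u t _ = lookup-replicate t 0

  dg-∂ : ∀ u → dg (∂ u) ≡ 0
  dg-∂ u = deg-zeros n

  -- probe c v w = x₁^c x_{v+1} ∂_{w+1}, meant for w = v + 1
  probe : ℕ → Fin n → Fin n → Basis
  probe c v w = w , mul (unit zero c) (unit v 1)

  module _ (c : ℕ) (v w : Fin n) where

    dg-probe : dg (probe c v w) ≡ suc c
    dg-probe = begin
      deg (mul (unit zero c) (unit v 1))     ≡⟨ deg-mul (unit zero c) (unit v 1) ⟩
      deg (unit {n} zero c) + deg (unit v 1) ≡⟨ cong₂ _+_ (deg-unit {n} zero c) (deg-unit v 1) ⟩
      c + 1                                  ≡⟨ +-comm c 1 ⟩
      suc c                                  ∎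
      where open ≡-Reasoning

    lookup-probe : 1 ≤ toℕ v → lookup (proj₂ (probe c v w)) v ≡ 1
    lookup-probe v≥1 = begin
      lookup (mul (unit zero c) (unit v 1)) v      ≡⟨ lookup-zipWith _+_ v (unit zero c) (unit v 1) ⟩
      lookup (unit zero c) v + lookup (unit v 1) v ≡⟨ cong₂ _+_ (lookup-unit-other zero v c (<⇒≢ v≥1)) (lookup-unit-same v 1) ⟩
      1                                            ∎
      where open ≡-Reasoning

    InB-probe : toℕ w ≡ suc (toℕ v) → InB (probe c v w)
    InB-probe w≡1+v t w≤t = begin
      lookup (mul (unit zero c) (unit v 1)) t      ≡⟨ lookup-zipWith _+_ t (unit zero c) (unit v 1) ⟩
      lookup (unit zero c) t + lookup (unit v 1) t ≡⟨ cong₂ _+_ (lookup-unit-other zero t c (<⇒≢ 0<t))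
                                                                (lookup-unit-other v t 1 (<⇒≢ v<t)) ⟩
      0                                            ∎
      where open ≡-Reasoning
            v<t : toℕ v < toℕ t
            v<t = subst (_≤ toℕ t) w≡1+v w≤t
            0<t : 0 < toℕ t
            0<t = ≤-trans (s≤s z≤n) v<t

    wd-probe : toℕ w ≡ suc (toℕ v) → wd (probe c v w) ≡ m
    wd-probe w≡1+v = begin
      excess Θ + codim w                ≡⟨ cong₂ (λ a b → (a ∸ b) + codim w) wt≡ dg-probe ⟩
      (suc c + toℕ v ∸ suc c) + codim w ≡⟨ cong₂ _+_ (m+n∸m≡n (suc c) (toℕ v)) (cong (λ z → n ∸ suc z) w≡1+v) ⟩
      toℕ v + (m ∸ toℕ v)               ≡⟨ m+[n∸m]≡n v≤m ⟩
      m                                 ∎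
      where
        open ≡-Reasoning
        Θ = mul (unit zero c) (unit v 1)
        wt≡ : wt Θ ≡ suc c + toℕ v
        wt≡ = begin
          wt Θ                                 ≡⟨ wtFrom-mul 1 (unit zero c) (unit v 1) ⟩
          wt (unit {n} zero c) + wt (unit v 1) ≡⟨ cong₂ _+_ (wtFrom-unit {n} 1 zero c) (wtFrom-unit 1 v 1) ⟩
          1 * c + suc (toℕ v) * 1              ≡⟨ collect c (toℕ v) ⟩
          suc c + toℕ v                        ∎
          where collect : ∀ c v → 1 * c + suc v * 1 ≡ suc c + v
                collect = solve-∀
        v≤m : toℕ v ≤ m
        v≤m = ≤-pred (≤-pred (subst (_< n) w≡1+v (toℕ<n w)))

  probe∈𝓝 : ∀ j (v w : Fin n) → toℕ w ≡ suc (toℕ v) → 𝓝 n (+ j) (probe (j / M) v w)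
  probe∈𝓝 j v w w≡1+v = LevelWithin⇒𝓝 j (probe (j / M) v w) (InB-probe (j / M) v w w≡1+v)
    (subst₂ (LevelWithin j) (sym (wd-probe (j / M) v w w≡1+v)) (sym (dg-probe (j / M) v w)) (LevelWithin-probe j))

  Normalizes : ℤ.ℤ → Basis → Set
  Normalizes i b = ∀ c → 𝓝 n i c → InSpan (𝓝 n i) (bracket b c)

  Normalizes-𝓝₋₁⇒dg≤1 : ∀ (b : Basis) → InB b → Normalizes ℤ.-1ℤ b → dg b ≤ 1
  Normalizes-𝓝₋₁⇒dg≤1 (k , Λ) Λ∈ normalizes with deg≡0⊎positive-entry Λ
  ... | inj₁ deg≡0      = ≤-trans (≤-reflexive deg≡0) z≤n
  ... | inj₂ (u , Λu≥1) = ≤-reflexive (begin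
    deg Λ                   ≡⟨ +-identityʳ (deg Λ) ⟨
    deg Λ + 0               ≡⟨ cong (_+_ (deg Λ)) (dg-∂ u) ⟨
    dg (k , Λ) + dg (∂ u)   ≡⟨ dg-bracket ⟨
    dg x + 1                ≡⟨ cong (_+ 1) (𝓝₋₁⇒dg≡0 x x∈) ⟩
    1                       ∎)
    where
      open ≡-Reasoning
      u<k = InB⇒positive-entry-below k Λ u Λ∈ Λu≥1
      x = (k , mul (decAt u Λ) zeros)
      x∈ = normalized-term-< k Λ normalizes u zeros (dg≡0⇒𝓝₋₁ (∂ u) (InB-∂ u) (dg-∂ u)) u<k Λu≥1
      open BracketTerm (bracket-term-< Λ zeros u<k Λ∈ (InB-∂ u) Λu≥1)

  LevelWithin-from-probe : ∀ j {b c x : Basis} → 𝓝 n (+ j) x → BracketTerm b c x →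
                           wd c ≡ m → dg c ≡ suc (j / M) → LevelWithin (suc j) (wd b) (dg b)
  LevelWithin-from-probe j {b} {c} {x} x∈ x∈[b,c] wc≡m dc≡ =
    LevelWithin-unbracket j (𝓝⇒LevelWithin j x x∈) wx+1≡wb dx≡
    where
      open BracketTerm x∈[b,c]
      wx+1≡wb : wd x + 1 ≡ wd b
      wx+1≡wb = +-cancelʳ-≡ m _ _ (trans (+-assoc (wd x) 1 m) (trans wd-bracket (cong (_+_ (wd b)) wc≡m)))
      dx≡ : dg x ≡ dg b + j / M
      dx≡ = +-cancelʳ-≡ 1 _ _ (begin
        dg x + 1              ≡⟨ dg-bracket ⟩
        dg b + dg c           ≡⟨ cong (_+_ (dg b)) dc≡ ⟩
        dg b + suc (j / M)    ≡⟨ +-suc (dg b) (j / M) ⟩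
        suc (dg b + j / M)    ≡⟨ +-comm 1 (dg b + j / M) ⟩
        dg b + j / M + 1      ∎)
        where open ≡-Reasoning

  module _ (j : ℕ) {k : Fin n} {Λ : Mono n} (Λ∈ : InB (k , Λ)) (normalizes : Normalizes (+ j) (k , Λ)) where

    LevelWithin-by-probe-< : ∀ v {u} → toℕ u ≡ suc (toℕ v) → 1 ≤ lookup Λ u → LevelWithin (suc j) (wd (k , Λ)) (deg Λ)
    LevelWithin-by-probe-< v {u} u≡1+v Λu≥1 =
      LevelWithin-from-probe j x∈ (bracket-term-< Λ Θ u<k Λ∈ (InB-probe (j / M) v u u≡1+v) Λu≥1)
                             (wd-probe (j / M) v u u≡1+v) (dg-probe (j / M) v u)
      where Θ = proj₂ (probe (j / M) v u)
            u<k = InB⇒positive-entry-below k Λ u Λ∈ Λu≥1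
            x∈ = normalized-term-< k Λ normalizes u Θ (probe∈𝓝 j v u u≡1+v) u<k Λu≥1

    LevelWithin-by-probe-> : ∀ {w} → toℕ w ≡ suc (toℕ k) → 1 ≤ toℕ k → LevelWithin (suc j) (wd (k , Λ)) (deg Λ)
    LevelWithin-by-probe-> {w} w≡1+k k≥1 =
      LevelWithin-from-probe j x∈ (bracket-term-> Λ Θ k<w Λ∈ (InB-probe (j / M) k w w≡1+k) Θk≥1)
                             (wd-probe (j / M) k w w≡1+k) (dg-probe (j / M) k w)
      where Θ = proj₂ (probe (j / M) k w)
            k<w : toℕ k < toℕ w
            k<w = subst (toℕ k <_) (sym w≡1+k) ≤-refl
            Θk≥1 : 1 ≤ lookup Θ k
            Θk≥1 = ≤-reflexive (sym (lookup-probe (j / M) k w k≥1))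
            x∈ = normalized-term-> k Λ normalizes w Θ (probe∈𝓝 j k w w≡1+k) k<w Θk≥1

    LevelWithin-by-∂ : ∀ {u} → 1 ≤ lookup Λ u → wd (k , Λ) ≡ 0 → LevelWithin (suc j) (wd (k , Λ)) (deg Λ)
    LevelWithin-by-∂ {u} Λu≥1 wd≡0 = subst (λ W → LevelWithin (suc j) W (deg Λ)) (sym wd≡0)
      (LevelWithin-unbracket-WD0 j (𝓝⇒LevelWithin j x x∈) dx+1≡db)
      where u<k = InB⇒positive-entry-below k Λ u Λ∈ Λu≥1
            x = (k , mul (decAt u Λ) zeros)
            ∂u∈ = dg≤1⇒𝓝 j (∂ u) (InB-∂ u) (≤-trans (≤-reflexive (dg-∂ u)) z≤n)
            x∈ = normalized-term-< k Λ normalizes u zeros ∂u∈ u<k Λu≥1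
            open BracketTerm (bracket-term-< Λ zeros u<k Λ∈ (InB-∂ u) Λu≥1)
            dx+1≡db = trans dg-bracket (trans (cong (_+_ (deg Λ)) (dg-∂ u)) (+-identityʳ (deg Λ)))

  Normalizes⇒LevelWithin-x₁-power : ∀ j {k : Fin n} x₀ xs → InB (k , x₀ ∷ xs) → Normalizes (+ j) (k , x₀ ∷ xs) →
                                    deg xs ≡ 0 → 1 ≤ x₀ → LevelWithin (suc j) (wd (k , x₀ ∷ xs)) (x₀ + deg xs)
  Normalizes⇒LevelWithin-x₁-power j {k} x₀ xs Λ∈ normalizes deg-xs≡0 x₀≥1 with suc (toℕ k) ≤? M
  ... | yes k<M = LevelWithin-by-probe-> j Λ∈ normalizes (toℕ-fromℕ< (s≤s k<M))
                                         (InB⇒positive-entry-below k (x₀ ∷ xs) zero Λ∈ x₀≥1)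
  ... | no  k≮M = LevelWithin-by-∂ j Λ∈ normalizes {zero} x₀≥1 wd≡0
    where
      k≡M : toℕ k ≡ M
      k≡M = ≤-antisym (≤-pred (toℕ<n k)) (≤-pred (≰⇒> k≮M))
      wt≡x₀ : wt (x₀ ∷ xs) ≡ x₀
      wt≡x₀ = trans (cong₂ _+_ (*-identityˡ x₀) (deg≡0⇒wtFrom≡0 2 xs deg-xs≡0)) (+-identityʳ x₀)
      wd≡0 : wd (k , x₀ ∷ xs) ≡ 0
      wd≡0 = cong₂ _+_ (trans (cong₂ _∸_ wt≡x₀ (trans (cong (_+_ x₀) deg-xs≡0) (+-identityʳ x₀))) (n∸n≡0 x₀))
                       (trans (cong (M ∸_) k≡M) (n∸n≡0 M))

  Normalizes⇒LevelWithin : ∀ j (b : Basis) → InB b → Normalizes (+ j) b → 2 ≤ dg b →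
                           LevelWithin (suc j) (wd b) (dg b)
  Normalizes⇒LevelWithin j (k , x₀ ∷ xs) Λ∈ normalizes dg≥2 with deg≡0⊎positive-entry xs
  ... | inj₂ (p , xs[p]≥1) =
    LevelWithin-by-probe-< j Λ∈ normalizes (inject₁ p) (cong suc (sym (toℕ-inject₁ p))) xs[p]≥1
  ... | inj₁ deg-xs≡0 = Normalizes⇒LevelWithin-x₁-power j x₀ xs Λ∈ normalizes deg-xs≡0
    (≤-trans (s≤s z≤n) (≤-trans dg≥2 (≤-reflexive (trans (cong (_+_ x₀) deg-xs≡0) (+-identityʳ x₀)))))

  Normalizer⇒𝓝 : ∀ j (b : Basis) → Normalizer (𝓝 n (+ j - + 1)) b → 𝓝 n (+ j) b
  Normalizer⇒𝓝 zero b (b∈ , normalizes) = dg≤1⇒𝓝 0 b b∈ (Normalizes-𝓝₋₁⇒dg≤1 b b∈ normalizes)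
  Normalizer⇒𝓝 (suc j) b (b∈ , normalizes) with dg b ≤? 1
  ... | yes dg≤1 = dg≤1⇒𝓝 (suc j) b b∈ dg≤1
  ... | no  dg≰1 = LevelWithin⇒𝓝 (suc j) b b∈ (Normalizes⇒LevelWithin j b b∈ normalizes (≰⇒> dg≰1))

proposition3p3 : (n : ℕ) → 2 ≤ n → (j : ℕ) → (b : RawB n) →
                 𝓝 n (+ j) b ⇔ Normalizer (𝓝 n (+ j - + 1)) b
proposition3p3 (suc (suc m)) _ j b = mk⇔ (𝓝⇒Normalizer m j b) (Normalizer⇒𝓝 m j b)
proposition3p3 (suc zero) (s≤s ()) j b
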